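{- There does not exist an isolation scheme for maximum-size independent sets on graphs of treedepth at most $4$ that uses $o(\log n)$ random bits and assigns polynomially bounded weights (where $n$ is the number of vertices).
   Context: For $\omega\colon[n]\to\mathbb{N}$, $\omega(X)=\sum_{x\in X}\omega(x)$, and $\omega$ isolates $\mathcal{F}\subseteq 2^{[n]}$ if exactly one member of $\mathcal{F}$ attains the minimum weight. An isolation scheme for maximum-size independent sets on a graph class $\mathcal{C}$ is, for every $n$, a list of weight functions $\omega_1,\ldots,\omega_\ell\colon[n]\to\mathbb{N}$ such that for every $G\in\mathcal{C}$ with vertex set $[n]$, at least half of the $\omega_i$ isolate the family of maximum-size independent sets of $G$; it uses $\log\ell$ random bits and its maximum weight is the largest value of the $\omega_i$. The treedepth of $G$ is the minimum height of a rooted forest $F$ on $V(G)$ such that every edge of $G$ joins an ancestor–descendant pair of $F$. -}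

module Defs where

open import Data.Nat using (ℕ; zero; suc; _+_; _*_; _^_; _≤_; _≥_)
open import Data.Bool using (Bool; true; false; if_then_else_)
open import Data.Fin using (Fin)
open import Data.Fin.Subset using (Subset; _∈_; ∣_∣)
open import Data.Vec using ([]; _∷_)
open import Data.Maybe using (Maybe; just; nothing)
open import Data.Product using (Σ; ∃; ∃-syntax; _×_)
open import Data.Sum using (_⊎_)
open import Relation.Binary.PropositionalEquality using (_≡_)
open import Relation.Nullary using (¬_)

record Graph (n : ℕ) : Set where
  field
    adj   : Fin n → Fin n → Bool
    sym   : ∀ u v → adj u v ≡ adj v u
    irrefl : ∀ v → adj v v ≡ false
open Graph public

weight : ∀ {n} → (Fin n → ℕ) → Subset n → ℕ
weight {zero}  ω []      = 0
weight {suc n} ω (b ∷ X) = (if b then ω Fin.zero else 0) + weight (λ i → ω (Fin.suc i)) X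

Isolates : ∀ {n} → (Fin n → ℕ) → (Subset n → Set) → Set
Isolates ω F =
  Σ _ λ X → F X
    × (∀ Y → F Y → weight ω X ≤ weight ω Y)
    × (∀ Y → F Y → weight ω Y ≤ weight ω X → Y ≡ X)

Independent : ∀ {n} → Graph n → Subset n → Set
Independent G X = ∀ u v → u ∈ X → v ∈ X → adj G u v ≡ false

MaxIndependent : ∀ {n} → Graph n → Subset n → Set
MaxIndependent G X = Independent G X × (∀ Y → Independent G Y → ∣ Y ∣ ≤ ∣ X ∣)

-- Rooted forests on [n], given by a parent map (nothing = root).
-- Ancestor par u v : u is an ancestor of v (reflexive).
data Ancestor {n : ℕ} (par : Fin n → Maybe (Fin n)) (u : Fin n) : Fin n → Set where
  anc-refl : Ancestor par u u
  anc-step : ∀ {v w} → par v ≡ just w → Ancestor par u w → Ancestor par u v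

-- A rooted forest of height at most d: the depth function (roots have depth 1,
-- children have depth one more than their parent) witnesses acyclicity, and all
-- depths are ≤ d (height = number of vertices on a longest root-to-leaf path).
record ForestOfHeight (n d : ℕ) : Set where
  field
    parent : Fin n → Maybe (Fin n)
    depth  : Fin n → ℕ
    root-depth  : ∀ v → parent v ≡ nothing → depth v ≡ 1
    child-depth : ∀ v w → parent v ≡ just w → depth v ≡ suc (depth w)
    bounded     : ∀ v → depth v ≤ d
open ForestOfHeight public

TreedepthAtMost : ∀ {n} → ℕ → Graph n → Set
TreedepthAtMost {n} d G =
  Σ (ForestOfHeight n d) λ F →
    ∀ u v → adj G u v ≡ true → Ancestor (parent F) u v ⊎ Ancestor (parent F) v u

IsIsolationScheme : ℕ → (ℓ : ℕ → ℕ) → ((n : ℕ) → Fin (ℓ n) → Fin n → ℕ) → Set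
IsIsolationScheme d ℓ ω =
  (∀ n → 1 ≤ ℓ n) ×
  (∀ n (G : Graph n) → TreedepthAtMost d G →
     ∃[ S ] (ℓ n ≤ 2 * ∣ S ∣ × (∀ i → i ∈ S → Isolates (ω n i) (MaxIndependent G))))

-- log ℓ(n) = o(log n): for every ε = 1/k, eventually log ℓ(n) ≤ (1/k) log n,
-- i.e. ℓ(n)^k ≤ n.
LittleOLog : (ℕ → ℕ) → Set
LittleOLog ℓ = ∀ k → ∃[ N ] ∀ n → n ≥ N → ℓ n ^ suc k ≤ n

PolyBoundedWeights : (ℓ : ℕ → ℕ) → ((n : ℕ) → Fin (ℓ n) → Fin n → ℕ) → Set
PolyBoundedWeights ℓ ω = ∃[ c ] ∃[ N ] ∀ n → n ≥ N → ∀ i v → ω n i v ≤ n ^ c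

-- Split the n = 2p vertices into p pairs, so that a map γ : [p] → {0,1} selects one vertex of
-- every pair. A scheme with L weight functions bounded by n^c gives every selection a vector of L
-- set weights below B = 1 + n^(c+1); once B^L < 2^p, two selections α ≠ β get the same vector.
-- From α and β one builds a graph of treedepth 4 whose only maximum independent sets are I α and
-- I β, where I γ consists of the pairs on which α and β agree together with the vertices selected
-- by γ. Then ω(I α) - ω(I β) = ω(α) - ω(β) = 0 for every weight function ω of the scheme, so none
-- of them isolates. If log ℓ(n) = o(log n) then ℓ(n)² ≤ n eventually, and this is enough to get
-- B^ℓ(n) < 2^(n/2) for suitable large n.
module Submission where

open import Defs hiding (sym)
open import Data.Bool using (Bool; true; false; if_then_else_; _∧_; _∨_; _xor_)
open import Data.Bool.Properties using (xor-same; xor-comm; ∧-zeroʳ; ∧-identityʳ; ∨-zeroʳ)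
open import Data.Fin using (Fin; zero; suc; _↑ˡ_; _↑ʳ_; combine; remQuot; funToFin; finToFun; fromℕ<)
open import Data.Fin.Patterns using (0F; 1F)
open import Data.Fin.Properties
  using (_≟_; remQuot-combine; combine-remQuot; pigeonhole; funToFin-finToFin; finToFun-funToFin; ¬∀⟶∃¬;
         fromℕ<-injective)
import Data.Fin.Properties as Fin
open import Data.Fin.Subset using (Subset; _∈_; _⊆_; _∪_; ∣_∣; Nonempty)
open import Data.Fin.Subset.Properties
  using (⊆-antisym; p⊂q⇒∣p∣<∣q∣; _∈?_; nonempty?; Empty-unique; ∣⊥∣≡0)
open import Data.Maybe using (Maybe; just; nothing)
open import Data.Nat hiding (_≟_)
open import Data.Nat.Properties hiding (_≟_)
open import Data.Nat.Tactic.RingSolver using (solve-∀)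
open import Algebra.Properties.CommutativeMonoid.Sum +-0-commutativeMonoid
  using (sum; sum-syntax; sum-cong-≗; ∑-distrib-+)
open import Data.Product using (∃; ∃₂; ∃-syntax; _×_; _,_; uncurry)
open import Data.Sum using (_⊎_; inj₁; inj₂; swap)
open import Data.Vec using ([]; _∷_; lookup; tabulate)
open import Data.Vec.Properties using (lookup-zipWith; lookup∘tabulate; lookup⇒[]=; []=⇒lookup)
open import Function using (_∘_; mk⇔)
open import Relation.Binary.PropositionalEquality
open import Relation.Nullary using (¬_; yes; no; does; contradiction)
open import Relation.Nullary.Decidable using (dec-true; dec-false; decidable-stable; does-⇔)

-- Arithmetic

m*m≤n*n⇒m≤n : ∀ {m n} → m * m ≤ n * n → m ≤ n
m*m≤n*n⇒m≤n m*m≤n*n = ≮⇒≥ (λ n<m → <⇒≱ (*-mono-< n<m n<m) m*m≤n*n)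

n<2^n : ∀ n → n < 2 ^ n
n<2^n zero    = s≤s z≤n
n<2^n (suc n) = +-mono-≤ (m^n>0 2 n) (≤-trans (n<2^n n) (m≤m+n _ 0))

[4+m]²≤2^[4+m] : ∀ m → (4 + m) * (4 + m) ≤ 2 ^ (4 + m)
[4+m]²≤2^[4+m] zero    = ≤-refl
[4+m]²≤2^[4+m] (suc m) = begin
  (5 + m) * (5 + m)                       ≤⟨ m≤m+n _ (7 + 6 * m + m * m) ⟩
  (5 + m) * (5 + m) + (7 + 6 * m + m * m) ≡⟨ expand m ⟩
  2 * ((4 + m) * (4 + m))                 ≤⟨ *-monoʳ-≤ 2 ([4+m]²≤2^[4+m] m) ⟩
  2 ^ (5 + m)                             ∎
  where
  open ≤-Reasoning
  expand : ∀ m → (5 + m) * (5 + m) + (7 + 6 * m + m * m) ≡ 2 * ((4 + m) * (4 + m))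
  expand = solve-∀

n*n≤2^n : ∀ {n} → 4 ≤ n → n * n ≤ 2 ^ n
n*n≤2^n {n} 4≤n = subst (λ k → k * k ≤ 2 ^ k) (m+[n∸m]≡n 4≤n) ([4+m]²≤2^[4+m] (n ∸ 4))

suc[2^n]≤2^[1+n] : ∀ n → suc (2 ^ n) ≤ 2 ^ suc n
suc[2^n]≤2^[1+n] n = +-mono-≤ (m^n>0 2 n) (m≤m+n (2 ^ n) 0)

1+[2q+2][c+1]<2^q : ∀ c t → let q = 2 * c + 6 + t in suc ((suc q + suc q) * suc c) < 2 ^ q
1+[2q+2][c+1]<2^q c t = ≤-trans (≤-trans (m≤m+n _ _) (≤-reflexive (square c t))) (n*n≤2^n 4≤q)
  where
  square : ∀ c t → let q = 2 * c + 6 + t in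
    suc (suc ((suc q + suc q) * suc c)) + (6 * c + 20 + 10 * t + 2 * c * t + t * t) ≡ q * q
  square = solve-∀
  4≤q : 4 ≤ 2 * c + 6 + t
  4≤q = ≤-trans (≤-trans (m≤m+n 4 2) (m≤n+m 6 (2 * c))) (m≤m+n _ t)

-- Taking p = 2^(2q+1) makes p * 2 = (2^(q+1))² a perfect square, so L² ≤ p * 2 gives L ≤ 2^(q+1).
enough-pairs : ∀ c N → ∃[ p ] N ≤ p * 2 × (∀ L → L ^ 2 ≤ p * 2 → suc ((p * 2) ^ suc c) ^ L < 2 ^ p)
enough-pairs c N = p , N≤p*2 , bound
  where
  open ≤-Reasoning
  q = 2 * c + 6 + N
  r = suc q
  p = 2 ^ (q + r)
  e = suc ((r + r) * suc c)

  N≤p*2 : N ≤ p * 2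
  N≤p*2 = begin
    N           ≤⟨ m≤n+m N (2 * c + 6) ⟩
    q           <⟨ n<2^n q ⟩
    2 ^ q       ≤⟨ ^-monoʳ-≤ 2 (≤-trans (n≤1+n q) (m≤m+n r r)) ⟩
    2 ^ (r + r) ≡⟨ *-comm 2 p ⟩
    p * 2       ∎

  1+[p*2]^[c+1]≤2^e : suc ((p * 2) ^ suc c) ≤ 2 ^ e
  1+[p*2]^[c+1]≤2^e = begin
    suc ((p * 2) ^ suc c)       ≡⟨ cong (λ n → suc (n ^ suc c)) (*-comm p 2) ⟩
    suc ((2 ^ (r + r)) ^ suc c) ≡⟨ cong suc (^-*-assoc 2 (r + r) (suc c)) ⟩
    suc (2 ^ ((r + r) * suc c)) ≤⟨ suc[2^n]≤2^[1+n] ((r + r) * suc c) ⟩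
    2 ^ e                       ∎

  bound : ∀ L → L ^ 2 ≤ p * 2 → suc ((p * 2) ^ suc c) ^ L < 2 ^ p
  bound L L²≤p*2 = begin-strict
    suc ((p * 2) ^ suc c) ^ L ≤⟨ ^-monoˡ-≤ L 1+[p*2]^[c+1]≤2^e ⟩
    (2 ^ e) ^ L               ≤⟨ ^-monoʳ-≤ (2 ^ e) {{m^n≢0 2 e}} L≤2^r ⟩
    (2 ^ e) ^ (2 ^ r)         ≡⟨ ^-*-assoc 2 e (2 ^ r) ⟩
    2 ^ (e * 2 ^ r)           <⟨ ^-monoʳ-< 2 (s≤s (s≤s z≤n)) e*2^r<2^q*2^r ⟩
    2 ^ (2 ^ q * 2 ^ r)       ≡⟨ cong (2 ^_) (^-distribˡ-+-* 2 q r) ⟨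
    2 ^ p                     ∎
    where
    e*2^r<2^q*2^r : e * 2 ^ r < 2 ^ q * 2 ^ r
    e*2^r<2^q*2^r = *-monoˡ-< (2 ^ r) {{m^n≢0 2 r}} (1+[2q+2][c+1]<2^q c N)
    L≤2^r : L ≤ 2 ^ r
    L≤2^r = m*m≤n*n⇒m≤n (begin
      L * L         ≡⟨ cong (L *_) (*-identityʳ L) ⟨
      L ^ 2         ≤⟨ L²≤p*2 ⟩
      p * 2         ≡⟨ *-comm p 2 ⟩
      2 ^ (r + r)   ≡⟨ ^-distribˡ-+-* 2 r r ⟩
      2 ^ r * 2 ^ r ∎)

sum-mono-≤ : ∀ {n} {f g : Fin n → ℕ} → (∀ i → f i ≤ g i) → sum f ≤ sum g
sum-mono-≤ {zero}  f≤g = z≤n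
sum-mono-≤ {suc n} f≤g = +-mono-≤ (f≤g zero) (sum-mono-≤ (f≤g ∘ suc))

sum-mono-< : ∀ {n} {f g : Fin n → ℕ} → (∀ i → f i ≤ g i) → ∀ i → f i < g i → sum f < sum g
sum-mono-< f≤g zero    fi<gi = +-mono-<-≤ fi<gi (sum-mono-≤ (f≤g ∘ suc))
sum-mono-< f≤g (suc i) fi<gi = +-mono-≤-< (f≤g zero) (sum-mono-< (f≤g ∘ suc) i fi<gi)

sum-↑ : ∀ m n (f : Fin (m + n) → ℕ) → sum f ≡ sum (f ∘ (_↑ˡ n)) + sum (f ∘ (m ↑ʳ_))
sum-↑ zero    n f = refl
sum-↑ (suc m) n f = trans (cong (f zero +_) (sum-↑ m n (f ∘ suc))) (sym (+-assoc (f zero) _ _))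

sum-combine : ∀ m n (f : Fin (m * n) → ℕ) → sum f ≡ ∑[ i < m ] ∑[ j < n ] f (combine i j)
sum-combine zero    n f = refl
sum-combine (suc m) n f =
  trans (sum-↑ n (m * n) f) (cong (sum (f ∘ (_↑ˡ m * n)) +_) (sum-combine m n (f ∘ (n ↑ʳ_))))

𝟙 : Bool → ℕ
𝟙 true  = 1
𝟙 false = 0

𝟙≤1 : ∀ b → 𝟙 b ≤ 1
𝟙≤1 true  = ≤-refl
𝟙≤1 false = z≤n

∣p∣≡sum : ∀ {n} (p : Subset n) → ∣ p ∣ ≡ ∑[ i < n ] 𝟙 (lookup p i)
∣p∣≡sum []          = refl
∣p∣≡sum (true  ∷ p) = cong suc (∣p∣≡sum p)
∣p∣≡sum (false ∷ p) = ∣p∣≡sum p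

0<∣p∣⇒Nonempty : ∀ {n} (p : Subset n) → 0 < ∣ p ∣ → Nonempty p
0<∣p∣⇒Nonempty {n} p 0<∣p∣ with nonempty? p
... | yes nonempty = nonempty
... | no  empty    = contradiction (subst (0 <_) (trans (cong ∣_∣ (Empty-unique empty)) (∣⊥∣≡0 n)) 0<∣p∣) λ ()

p⊆q∧∣q∣≤∣p∣⇒p≡q : ∀ {n} {p q : Subset n} → p ⊆ q → ∣ q ∣ ≤ ∣ p ∣ → p ≡ q
p⊆q∧∣q∣≤∣p∣⇒p≡q {p = p} p⊆q ∣q∣≤∣p∣ = ⊆-antisym p⊆q λ {x} x∈q →
  decidable-stable (x ∈? p) (λ x∉p → <⇒≱ (p⊂q⇒∣p∣<∣q∣ (p⊆q , x , x∈q , x∉p)) ∣q∣≤∣p∣)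

weight≡sum : ∀ {n} (ω : Fin n → ℕ) (p : Subset n) → weight ω p ≡ ∑[ i < n ] (if lookup p i then ω i else 0)
weight≡sum ω []      = refl
weight≡sum ω (b ∷ p) = cong ((if b then ω zero else 0) +_) (weight≡sum (ω ∘ suc) p)

weight≤ : ∀ {n} (ω : Fin n → ℕ) {m} → (∀ i → ω i ≤ m) → ∀ p → weight ω p ≤ n * m
weight≤ ω ω≤m []          = z≤n
weight≤ ω ω≤m (true  ∷ p) = +-mono-≤ (ω≤m zero) (weight≤ (ω ∘ suc) (ω≤m ∘ suc) p)
weight≤ ω ω≤m (false ∷ p) = ≤-trans (weight≤ (ω ∘ suc) (ω≤m ∘ suc) p) (m≤n+m _ _)

if-∨-exchange : ∀ f a b m → (f ≡ true → a ≡ b) →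
  (if f ∨ a then m else 0) + (if b then m else 0) ≡ (if f ∨ b then m else 0) + (if a then m else 0)
if-∨-exchange true  a b m a≡b rewrite a≡b refl = refl
if-∨-exchange false a b m _ = +-comm (if a then m else 0) (if b then m else 0)

weight-∪-exchange : ∀ {n} (ω : Fin n → ℕ) (f p q : Subset n) →
  (∀ i → lookup f i ≡ true → lookup p i ≡ lookup q i) →
  weight ω (f ∪ p) + weight ω q ≡ weight ω (f ∪ q) + weight ω p
weight-∪-exchange {n} ω f p q p≡q-on-f = begin
  weight ω (f ∪ p) + weight ω q        ≡⟨ cong₂ _+_ (weight≡sum ω (f ∪ p)) (weight≡sum ω q) ⟩
  sum (ind (f ∪ p)) + sum (ind q)      ≡⟨ ∑-distrib-+ (ind (f ∪ p)) (ind q) ⟨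
  ∑[ i < n ] (ind (f ∪ p) i + ind q i) ≡⟨ sum-cong-≗ exchange ⟩
  ∑[ i < n ] (ind (f ∪ q) i + ind p i) ≡⟨ ∑-distrib-+ (ind (f ∪ q)) (ind p) ⟩
  sum (ind (f ∪ q)) + sum (ind p)      ≡⟨ cong₂ _+_ (weight≡sum ω (f ∪ q)) (weight≡sum ω p) ⟨
  weight ω (f ∪ q) + weight ω p        ∎
  where
  open ≡-Reasoning
  ind : Subset n → Fin n → ℕ
  ind r i = if lookup r i then ω i else 0
  exchange : ∀ i → ind (f ∪ p) i + ind q i ≡ ind (f ∪ q) i + ind p i
  exchange i rewrite lookup-zipWith _∨_ i f p | lookup-zipWith _∨_ i f q =
    if-∨-exchange (lookup f i) (lookup p i) (lookup q i) (ω i) (p≡q-on-f i)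

¬Isolates-pair : ∀ {n} {ω : Fin n → ℕ} {F : Subset n → Set} {A B : Subset n} →
  F A → F B → A ≢ B → (∀ X → F X → X ≡ A ⊎ X ≡ B) → weight ω A ≡ weight ω B → ¬ Isolates ω F
¬Isolates-pair FA FB A≢B A-or-B ωA≡ωB (X , FX , _ , unique) with A-or-B X FX
... | inj₁ refl = A≢B (sym (unique _ FB (≤-reflexive (sym ωA≡ωB))))
... | inj₂ refl = A≢B (unique _ FA (≤-reflexive ωA≡ωB))

funToFin-cong : ∀ {m n} {f g : Fin m → Fin n} → f ≗ g → funToFin f ≡ funToFin g
funToFin-cong {zero}  f≗g = refl
funToFin-cong {suc m} f≗g = cong₂ combine (f≗g zero) (funToFin-cong (f≗g ∘ suc))

pigeonhole-→ : ∀ {k l m n} → n ^ m < k ^ l → (h : (Fin l → Fin k) → (Fin m → Fin n)) →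
  ∃₂ λ f g → (∃ λ x → f x ≢ g x) × h f ≗ h g
pigeonhole-→ {k} {l} n^m<k^l h with pigeonhole n^m<k^l (funToFin ∘ h ∘ finToFun)
... | i , j , i<j , hᵢ≡hⱼ = f , g , differ , same
  where
  open ≡-Reasoning
  f g : Fin l → Fin k
  f = finToFun i
  g = finToFun j
  differ : ∃ λ x → f x ≢ g x
  differ = ¬∀⟶∃¬ l _ (λ x → f x ≟ g x) λ f≗g → Fin.<⇒≢ i<j (begin
    i          ≡⟨ funToFin-finToFin {l} {k} i ⟨
    funToFin f ≡⟨ funToFin-cong f≗g ⟩
    funToFin g ≡⟨ funToFin-finToFin {l} {k} j ⟩
    j          ∎)
  same : h f ≗ h g
  same x = begin
    h f x                       ≡⟨ finToFun-funToFin (h f) x ⟨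
    finToFun (funToFin (h f)) x ≡⟨ cong (λ c → finToFun c x) hᵢ≡hⱼ ⟩
    finToFun (funToFin (h g)) x ≡⟨ finToFun-funToFin (h g) x ⟩
    h g x                       ∎

module _ {m n : ℕ} where

  vertex : Fin m → Fin n → Fin (m * n)
  vertex = combine

  atPair : ∀ {a} {A : Set a} → (Fin m → Fin n → A) → Fin (m * n) → A
  atPair f v = uncurry f (remQuot n v)

  atPair-vertex : ∀ {a} {A : Set a} (f : Fin m → Fin n → A) i j → atPair f (vertex i j) ≡ f i j
  atPair-vertex f i j = cong (uncurry f) (remQuot-combine i j)

  ∀-vertex : ∀ {a} (P : Fin (m * n) → Set a) → (∀ i j → P (vertex i j)) → ∀ v → P v
  ∀-vertex P P-vertex v = subst P (combine-remQuot {m} n v) (P-vertex _ _)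

  ∀-vertex₂ : ∀ {a} (P : Fin (m * n) → Fin (m * n) → Set a) →
    (∀ i j i' j' → P (vertex i j) (vertex i' j')) → ∀ u v → P u v
  ∀-vertex₂ P P-vertex u = ∀-vertex (P u) (∀-vertex (λ u → ∀ i' j' → P u (vertex i' j')) P-vertex u)

  ⊆-via-vertex : ∀ {X Y : Subset (m * n)} → (∀ i j → vertex i j ∈ X → vertex i j ∈ Y) → X ⊆ Y
  ⊆-via-vertex {X} {Y} X⊆Y {v} = ∀-vertex (λ v → v ∈ X → v ∈ Y) X⊆Y v

  onPairs : (Fin m → Fin n → Bool) → Subset (m * n)
  onPairs f = tabulate (atPair f)

  lookup-onPairs : ∀ f i j → lookup (onPairs f) (vertex i j) ≡ f i j
  lookup-onPairs f i j = trans (lookup∘tabulate (atPair f) (vertex i j)) (atPair-vertex f i j)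

  ∣p∣≡∑∑ : ∀ (X : Subset (m * n)) → ∣ X ∣ ≡ ∑[ i < m ] ∑[ j < n ] 𝟙 (lookup X (vertex i j))
  ∣p∣≡∑∑ X = trans (∣p∣≡sum X) (sum-combine m n _)

  pairGraph : (E : Fin m × Fin n → Fin m × Fin n → Bool) →
    (∀ x y → E x y ≡ E y x) → (∀ x → E x x ≡ false) → Graph (m * n)
  pairGraph E E-sym E-irrefl = record
    { adj    = λ u v → E (remQuot n u) (remQuot n v)
    ; sym    = λ u v → E-sym (remQuot n u) (remQuot n v)
    ; irrefl = λ v → E-irrefl (remQuot n v)
    }

  adj-pairGraph : ∀ E E-sym E-irrefl i j i' j' →
    adj (pairGraph E E-sym E-irrefl) (vertex i j) (vertex i' j') ≡ E (i , j) (i' , j')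
  adj-pairGraph E _ _ i j i' j' = cong₂ E (remQuot-combine i j) (remQuot-combine i' j')

selection : ∀ {m n} → (Fin m → Fin n) → Subset (m * n)
selection γ = onPairs λ i j → does (j ≟ γ i)

does-≟-sym : ∀ {n} (i j : Fin n) → does (i ≟ j) ≡ does (j ≟ i)
does-≟-sym i j = does-⇔ (mk⇔ sym sym) (i ≟ j) (j ≟ i)

does-≟-true : ∀ {n} {i j : Fin n} → does (i ≟ j) ≡ true → i ≡ j
does-≟-true {i = i} {j} eq with i ≟ j
... | yes i≡j = i≡j
... | no  _   = contradiction eq λ ()

does-≟-injective : ∀ {a s t : Fin 2} → does (s ≟ a) ≡ does (t ≟ a) → s ≡ t
does-≟-injective {0F} {0F} {0F} _ = refl
does-≟-injective {0F} {1F} {1F} _ = refl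
does-≟-injective {1F} {0F} {0F} _ = refl
does-≟-injective {1F} {1F} {1F} _ = refl
does-≟-injective {0F} {0F} {1F} ()
does-≟-injective {0F} {1F} {0F} ()
does-≟-injective {1F} {0F} {1F} ()
does-≟-injective {1F} {1F} {0F} ()

0F-xor-1F : ∀ (a : Fin 2) → does (0F ≟ a) xor does (1F ≟ a) ≡ true
0F-xor-1F 0F = refl
0F-xor-1F 1F = refl

Fin2-cover : ∀ {a b : Fin 2} → a ≢ b → ∀ s → s ≡ a ⊎ s ≡ b
Fin2-cover {0F} {0F} a≢b _  = contradiction refl a≢b
Fin2-cover {0F} {1F} _   0F = inj₁ refl
Fin2-cover {0F} {1F} _   1F = inj₂ refl
Fin2-cover {1F} {0F} _   0F = inj₂ refl
Fin2-cover {1F} {0F} _   1F = inj₁ refl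
Fin2-cover {1F} {1F} a≢b _  = contradiction refl a≢b

xor≡false⇒≡ : ∀ x y → x xor y ≡ false → x ≡ y
xor≡false⇒≡ false false _ = refl
xor≡false⇒≡ true  true  _ = refl

-- The gadget graph

Ancestor-trans : ∀ {n} {par : Fin n → Maybe (Fin n)} {u v w} →
  Ancestor par u v → Ancestor par v w → Ancestor par u w
Ancestor-trans u≺v anc-refl          = u≺v
Ancestor-trans u≺v (anc-step eq v≺w) = anc-step eq (Ancestor-trans u≺v v≺w)

-- Vertex (j , s) is the s-th vertex of pair j, on the α-side if s = α j. Pairs with α j = β j are
-- free and their vertices isolated. Otherwise two vertices on opposite sides are adjacent when one
-- of them lies in the hub pair j₀ or when they form a (leaf) pair.
module Gadget {p : ℕ} (α β : Fin p → Fin 2) (j₀ : Fin p) (α₀≢β₀ : α j₀ ≢ β j₀) where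

  data Shape : Set where
    free hub leaf : Shape

  shape : Fin p → Shape
  shape j with α j ≟ β j | j ≟ j₀
  ... | yes _ | _     = free
  ... | no  _ | yes _ = hub
  ... | no  _ | no  _ = leaf

  data ShapeSpec (j : Fin p) : Shape → Set where
    free : α j ≡ β j → ShapeSpec j free
    hub  : α j ≢ β j → j ≡ j₀ → ShapeSpec j hub
    leaf : α j ≢ β j → j ≢ j₀ → ShapeSpec j leaf

  shape-spec : ∀ j → ShapeSpec j (shape j)
  shape-spec j with α j ≟ β j | j ≟ j₀
  ... | yes αⱼ≡βⱼ | _        = free αⱼ≡βⱼ
  ... | no  αⱼ≢βⱼ | yes j≡j₀ = hub αⱼ≢βⱼ j≡j₀
  ... | no  αⱼ≢βⱼ | no  j≢j₀ = leaf αⱼ≢βⱼ j≢j₀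

  shape-j₀ : shape j₀ ≡ hub
  shape-j₀ with shape j₀ | shape-spec j₀
  ... | free | free α₀≡β₀   = contradiction α₀≡β₀ α₀≢β₀
  ... | hub  | hub _ _      = refl
  ... | leaf | leaf _ j₀≢j₀ = contradiction refl j₀≢j₀

  shape-leaf : ∀ {j} → α j ≢ β j → j ≢ j₀ → shape j ≡ leaf
  shape-leaf {j} αⱼ≢βⱼ j≢j₀ with shape j | shape-spec j
  ... | free | free αⱼ≡βⱼ = contradiction αⱼ≡βⱼ αⱼ≢βⱼ
  ... | hub  | hub _ j≡j₀ = contradiction j≡j₀ j≢j₀
  ... | leaf | leaf _ _   = refl

  leaf⇒α≢β : ∀ {j} → shape j ≡ leaf → α j ≢ β j
  leaf⇒α≢β {j} leafⱼ with shape j | shape-spec j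
  ... | leaf | leaf αⱼ≢βⱼ _ = αⱼ≢βⱼ

  free? : Shape → Bool
  free? free = true
  free? _    = false

  free⇒α≡β : ∀ {j} → free? (shape j) ≡ true → α j ≡ β j
  free⇒α≡β {j} freeⱼ with shape j | shape-spec j
  ... | free | free αⱼ≡βⱼ = αⱼ≡βⱼ

  side : Fin p → Fin 2 → Bool
  side j s = does (s ≟ α j)

  side-α : ∀ j → side j (α j) ≡ true
  side-α j = dec-true (α j ≟ α j) refl

  side-β : ∀ {j} → α j ≢ β j → side j (β j) ≡ false
  side-β αⱼ≢βⱼ = dec-false (_ ≟ _) (αⱼ≢βⱼ ∘ sym)

  side≡true⇒≡α : ∀ {j s} → side j s ≡ true → s ≡ α j
  side≡true⇒≡α {j} sideⱼ≡true = does-≟-injective (trans sideⱼ≡true (sym (side-α j)))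

  side≡false⇒≡β : ∀ {j s} → α j ≢ β j → side j s ≡ false → s ≡ β j
  side≡false⇒≡β αⱼ≢βⱼ sideⱼ≡false = does-≟-injective (trans sideⱼ≡false (sym (side-β αⱼ≢βⱼ)))

  record OneSided (γ : Fin p → Fin 2) (b : Bool) : Set where
    constructor one-sided
    field side-γ : ∀ j → α j ≢ β j → side j (γ j) ≡ b

  open OneSided

  α-one-sided : OneSided α true
  α-one-sided = one-sided λ j _ → side-α j

  β-one-sided : OneSided β false
  β-one-sided = one-sided λ j → side-β

  side≡b⇒≡γ : ∀ {γ b j s} → OneSided γ b → α j ≢ β j → side j s ≡ b → s ≡ γ j
  side≡b⇒≡γ {j = j} oneSided αⱼ≢βⱼ sideb =
    does-≟-injective {α j} (trans sideb (sym (side-γ oneSided j αⱼ≢βⱼ)))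

  link : Shape → Shape → Bool → Bool
  link hub  hub  _         = true
  link hub  leaf _         = true
  link leaf hub  _         = true
  link leaf leaf same-pair = same-pair
  link _    _    _         = false

  link-sym : ∀ k k' b → link k k' b ≡ link k' k b
  link-sym free free b = refl
  link-sym free hub  b = refl
  link-sym free leaf b = refl
  link-sym hub  free b = refl
  link-sym hub  hub  b = refl
  link-sym hub  leaf b = refl
  link-sym leaf free b = refl
  link-sym leaf hub  b = refl
  link-sym leaf leaf b = refl

  adjacent : Fin p × Fin 2 → Fin p × Fin 2 → Bool
  adjacent (j , s) (j' , s') = (side j s xor side j' s') ∧ link (shape j) (shape j') (does (j ≟ j'))

  adjacent-sym : ∀ x y → adjacent x y ≡ adjacent y x
  adjacent-sym (j , s) (j' , s') = cong₂ _∧_ (xor-comm (side j s) (side j' s')) (begin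
    link (shape j) (shape j') (does (j ≟ j')) ≡⟨ link-sym (shape j) (shape j') _ ⟩
    link (shape j') (shape j) (does (j ≟ j')) ≡⟨ cong (link (shape j') (shape j)) (does-≟-sym j j') ⟩
    link (shape j') (shape j) (does (j' ≟ j)) ∎)
    where open ≡-Reasoning

  adjacent-irrefl : ∀ x → adjacent x x ≡ false
  adjacent-irrefl (j , s) rewrite xor-same (side j s) = refl

  G : Graph (p * 2)
  G = pairGraph adjacent adjacent-sym adjacent-irrefl

  adj-G : ∀ j s j' s' → adj G (vertex j s) (vertex j' s') ≡ adjacent (j , s) (j' , s')
  adj-G = adj-pairGraph adjacent adjacent-sym adjacent-irrefl

  hubα hubβ : Fin (p * 2)
  hubα = vertex j₀ (α j₀)
  hubβ = vertex j₀ (β j₀)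

  -- A path hubα — hubβ — (j , β j) — (j , α j) of the forest for every leaf pair j.
  parentAt : Fin p → Shape → Bool → Maybe (Fin (p * 2))
  parentAt j hub  false = just hubα
  parentAt j leaf false = just hubβ
  parentAt j leaf true  = just (vertex j (β j))
  parentAt j _    _     = nothing

  levelAt : Shape → Bool → ℕ
  levelAt free _     = 1
  levelAt hub  true  = 1
  levelAt hub  false = 2
  levelAt leaf false = 3
  levelAt leaf true  = 4

  up : Fin (p * 2) → Maybe (Fin (p * 2))
  up = atPair λ j s → parentAt j (shape j) (side j s)

  level : Fin (p * 2) → ℕ
  level = atPair λ j s → levelAt (shape j) (side j s)

  up-vertex : ∀ j s → up (vertex j s) ≡ parentAt j (shape j) (side j s)
  up-vertex = atPair-vertex λ j s → parentAt j (shape j) (side j s)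

  level-vertex : ∀ j s → level (vertex j s) ≡ levelAt (shape j) (side j s)
  level-vertex = atPair-vertex λ j s → levelAt (shape j) (side j s)

  level-hubα : level hubα ≡ 1
  level-hubα = trans (level-vertex j₀ (α j₀)) (cong₂ levelAt shape-j₀ (side-α j₀))

  level-hubβ : level hubβ ≡ 2
  level-hubβ = trans (level-vertex j₀ (β j₀)) (cong₂ levelAt shape-j₀ (side-β α₀≢β₀))

  level-leafβ : ∀ {j} → shape j ≡ leaf → level (vertex j (β j)) ≡ 3
  level-leafβ {j} leafⱼ = trans (level-vertex j (β j)) (cong₂ levelAt leafⱼ (side-β (leaf⇒α≢β leafⱼ)))

  levelAt-root : ∀ j k b → parentAt j k b ≡ nothing → levelAt k b ≡ 1
  levelAt-root j free b     _  = refl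
  levelAt-root j hub  true  _  = refl
  levelAt-root j hub  false ()
  levelAt-root j leaf false ()
  levelAt-root j leaf true  ()

  levelAt-child : ∀ j k b {w} → shape j ≡ k → parentAt j k b ≡ just w → levelAt k b ≡ suc (level w)
  levelAt-child j hub  false _     refl = cong suc (sym level-hubα)
  levelAt-child j leaf false _     refl = cong suc (sym level-hubβ)
  levelAt-child j leaf true  leafⱼ refl = cong suc (sym (level-leafβ leafⱼ))

  levelAt≤4 : ∀ k b → levelAt k b ≤ 4
  levelAt≤4 free b     = s≤s z≤n
  levelAt≤4 hub  true  = s≤s z≤n
  levelAt≤4 hub  false = s≤s (s≤s z≤n)
  levelAt≤4 leaf false = s≤s (s≤s (s≤s z≤n))
  levelAt≤4 leaf true  = ≤-refl

  forest : ForestOfHeight (p * 2) 4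
  forest = record
    { parent      = up
    ; depth       = level
    ; root-depth  = λ v → levelAt-root _ _ _
    ; child-depth = λ v w → levelAt-child _ _ _ refl
    ; bounded     = λ v → levelAt≤4 _ _
    }

  up⇒≺ : ∀ {v w} → up v ≡ just w → Ancestor up w v
  up⇒≺ up-v≡w = anc-step up-v≡w anc-refl

  hubα≺hubβ : Ancestor up hubα hubβ
  hubα≺hubβ = up⇒≺ (trans (up-vertex j₀ (β j₀)) (cong₂ (parentAt j₀) shape-j₀ (side-β α₀≢β₀)))

  hubβ≺leafβ : ∀ {j} → shape j ≡ leaf → Ancestor up hubβ (vertex j (β j))
  hubβ≺leafβ {j} leafⱼ = up⇒≺ (trans (up-vertex j (β j)) (cong₂ (parentAt j) leafⱼ (side-β (leaf⇒α≢β leafⱼ))))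

  leafβ≺leafα : ∀ {j} → shape j ≡ leaf → Ancestor up (vertex j (β j)) (vertex j (α j))
  leafβ≺leafα {j} leafⱼ = up⇒≺ (trans (up-vertex j (α j)) (cong₂ (parentAt j) leafⱼ (side-α j)))

  hubα≺leafβ : ∀ {j} → shape j ≡ leaf → Ancestor up hubα (vertex j (β j))
  hubα≺leafβ leafⱼ = Ancestor-trans hubα≺hubβ (hubβ≺leafβ leafⱼ)

  hubβ≺leafα : ∀ {j} → shape j ≡ leaf → Ancestor up hubβ (vertex j (α j))
  hubβ≺leafα leafⱼ = Ancestor-trans (hubβ≺leafβ leafⱼ) (leafβ≺leafα leafⱼ)

  at-hubα : ∀ {j s} → j ≡ j₀ → side j s ≡ true → vertex j s ≡ hubα
  at-hubα {j} j≡j₀ sideα = cong₂ vertex j≡j₀ (trans (side≡true⇒≡α {j} sideα) (cong α j≡j₀))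

  at-hubβ : ∀ {j s} → j ≡ j₀ → side j s ≡ false → vertex j s ≡ hubβ
  at-hubβ {j} refl sideβ = cong (vertex j) (side≡false⇒≡β {j} α₀≢β₀ sideβ)

  at-leafα : ∀ {j s} → side j s ≡ true → vertex j s ≡ vertex j (α j)
  at-leafα {j} sideα = cong (vertex j) (side≡true⇒≡α {j} sideα)

  at-leafβ : ∀ {j s} → α j ≢ β j → side j s ≡ false → vertex j s ≡ vertex j (β j)
  at-leafβ {j} αⱼ≢βⱼ sideβ = cong (vertex j) (side≡false⇒≡β {j} αⱼ≢βⱼ sideβ)

  Comparable : Fin (p * 2) → Fin (p * 2) → Set
  Comparable u v = Ancestor up u v ⊎ Ancestor up v u

  linked-comparable : ∀ j s j' s' → side j s ≡ true → side j' s' ≡ false →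
    link (shape j) (shape j') (does (j ≟ j')) ≡ true → Comparable (vertex j s) (vertex j' s')
  linked-comparable j s j' s' sideα sideβ linked with shape j | shape-spec j | shape j' | shape-spec j'
  ... | hub  | hub _ j≡j₀       | hub  | hub _ j'≡j₀ =
    subst₂ Comparable (sym (at-hubα j≡j₀ sideα)) (sym (at-hubβ j'≡j₀ sideβ)) (inj₁ hubα≺hubβ)
  ... | hub  | hub _ j≡j₀       | leaf | leaf αⱼ'≢βⱼ' j'≢j₀ =
    subst₂ Comparable (sym (at-hubα j≡j₀ sideα)) (sym (at-leafβ αⱼ'≢βⱼ' sideβ))
      (inj₁ (hubα≺leafβ (shape-leaf αⱼ'≢βⱼ' j'≢j₀)))
  ... | leaf | leaf αⱼ≢βⱼ j≢j₀ | hub  | hub _ j'≡j₀ =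
    subst₂ Comparable (sym (at-leafα sideα)) (sym (at-hubβ j'≡j₀ sideβ))
      (inj₂ (hubβ≺leafα (shape-leaf αⱼ≢βⱼ j≢j₀)))
  ... | leaf | leaf αⱼ≢βⱼ j≢j₀ | leaf | leaf _ _ with refl ← does-≟-true {i = j} {j'} linked =
    subst₂ Comparable (sym (at-leafα sideα)) (sym (at-leafβ αⱼ≢βⱼ sideβ))
      (inj₂ (leafβ≺leafα (shape-leaf αⱼ≢βⱼ j≢j₀)))

  adjacent-comparable : ∀ j s j' s' → adjacent (j , s) (j' , s') ≡ true →
    Comparable (vertex j s) (vertex j' s')
  adjacent-comparable j s j' s' adjacent≡true with side j s in sideⱼ | side j' s' in sideⱼ'
  ... | true  | false = linked-comparable j s j' s' sideⱼ sideⱼ' adjacent≡true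
  ... | false | true  = swap (linked-comparable j' s' j s sideⱼ' sideⱼ (begin
    link (shape j') (shape j) (does (j' ≟ j)) ≡⟨ link-sym (shape j') (shape j) _ ⟩
    link (shape j) (shape j') (does (j' ≟ j)) ≡⟨ cong (link (shape j) (shape j')) (does-≟-sym j' j) ⟩
    link (shape j) (shape j') (does (j ≟ j')) ≡⟨ adjacent≡true ⟩
    true                                      ∎))
    where open ≡-Reasoning

  treedepth≤4 : TreedepthAtMost 4 G
  treedepth≤4 = forest , ∀-vertex₂ (λ u v → adj G u v ≡ true → Comparable u v) λ j s j' s' adj≡true →
    adjacent-comparable j s j' s' (trans (sym (adj-G j s j' s')) adj≡true)

  freeVertices : Subset (p * 2)
  freeVertices = onPairs λ j _ → free? (shape j)

  I : (Fin p → Fin 2) → Subset (p * 2)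
  I γ = freeVertices ∪ selection γ

  lookup-I : ∀ γ j s → lookup (I γ) (vertex j s) ≡ free? (shape j) ∨ does (s ≟ γ j)
  lookup-I γ j s = trans (lookup-zipWith _∨_ (vertex j s) freeVertices (selection γ))
    (cong₂ _∨_ (lookup-onPairs (λ j _ → free? (shape j)) j s) (lookup-onPairs (λ j s → does (s ≟ γ j)) j s))

  ∈I : ∀ γ j s → free? (shape j) ∨ does (s ≟ γ j) ≡ true → vertex j s ∈ I γ
  ∈I γ j s member = lookup⇒[]= (vertex j s) (I γ) (trans (lookup-I γ j s) member)

  I-member : ∀ {γ b j s} → OneSided γ b → vertex j s ∈ I γ → shape j ≡ free ⊎ side j s ≡ b
  I-member {γ} {b} {j} {s} oneSided v∈I
    with shape j | shape-spec j | trans (sym (lookup-I γ j s)) ([]=⇒lookup v∈I)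
  ... | free | _            | _      = inj₁ refl
  ... | hub  | hub  αⱼ≢βⱼ _ | member =
    inj₂ (trans (cong (side j) (does-≟-true {i = s} {γ j} member)) (side-γ oneSided j αⱼ≢βⱼ))
  ... | leaf | leaf αⱼ≢βⱼ _ | member =
    inj₂ (trans (cong (side j) (does-≟-true {i = s} {γ j} member)) (side-γ oneSided j αⱼ≢βⱼ))

  free-nonadjacent : ∀ {j s} y → shape j ≡ free → adjacent (j , s) y ≡ false
  free-nonadjacent {j} {s} (j' , s') freeⱼ rewrite freeⱼ = ∧-zeroʳ (side j s xor side j' s')

  same-side-nonadjacent : ∀ {j s j' s'} → side j s ≡ side j' s' → adjacent (j , s) (j' , s') ≡ false
  same-side-nonadjacent {j} {s} {j'} {s'} same rewrite same | xor-same (side j' s') = refl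

  I-independent : ∀ {γ b} → OneSided γ b → Independent G (I γ)
  I-independent {γ} {b} oneSided =
    ∀-vertex₂ (λ u v → u ∈ I γ → v ∈ I γ → adj G u v ≡ false) λ j s j' s' v∈I v'∈I →
    trans (adj-G j s j' s') (nonadjacent (j , s) (j' , s')
      (I-member {γ} {b} {j} {s} oneSided v∈I) (I-member {γ} {b} {j'} {s'} oneSided v'∈I))
    where
    nonadjacent : ∀ x y → let (j , s) = x; (j' , s') = y in
      shape j ≡ free ⊎ side j s ≡ b → shape j' ≡ free ⊎ side j' s' ≡ b → adjacent x y ≡ false
    nonadjacent (j , s)  y         (inj₁ freeⱼ) _             = free-nonadjacent {j} {s} y freeⱼ
    nonadjacent x        (j , s)   (inj₂ _)     (inj₁ freeⱼ)  =
      trans (adjacent-sym x (j , s)) (free-nonadjacent {j} {s} x freeⱼ)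
    nonadjacent (j , s)  (j' , s') (inj₂ sideb) (inj₂ sideb') =
      same-side-nonadjacent {j} {s} {j'} {s'} (trans sideb (sym sideb'))

  hub-side : ∀ {γ b} → OneSided γ b → ∀ {j s} → side j₀ (γ j₀) xor side j s ≡ false → side j s ≡ b
  hub-side oneSided different = trans (sym (xor≡false⇒≡ _ _ different)) (side-γ oneSided j₀ α₀≢β₀)

  hub-non-neighbour : ∀ {γ b} → OneSided γ b → ∀ j s → adjacent (j₀ , γ j₀) (j , s) ≡ false →
    free? (shape j) ∨ does (s ≟ γ j) ≡ true
  hub-non-neighbour {γ} oneSided j s nonadjacent rewrite shape-j₀ with shape j | shape-spec j
  ... | free | free _       = refl
  ... | hub  | hub  αⱼ≢βⱼ _ = dec-true (s ≟ γ j) (side≡b⇒≡γ {j = j} {s} oneSided αⱼ≢βⱼ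
    (hub-side oneSided {j} {s} (trans (sym (∧-identityʳ _)) nonadjacent)))
  ... | leaf | leaf αⱼ≢βⱼ _ = dec-true (s ≟ γ j) (side≡b⇒≡γ {j = j} {s} oneSided αⱼ≢βⱼ
    (hub-side oneSided {j} {s} (trans (sym (∧-identityʳ _)) nonadjacent)))

  ⊆I : ∀ {γ b X} → OneSided γ b → Independent G X → vertex j₀ (γ j₀) ∈ X → X ⊆ I γ
  ⊆I {γ} oneSided indX hub∈X = ⊆-via-vertex λ j s v∈X →
    ∈I γ j s (hub-non-neighbour oneSided j s (trans (sym (adj-G j₀ (γ j₀) j s)) (indX _ _ hub∈X v∈X)))

  capacity : Shape → ℕ
  capacity free = 2
  capacity hub  = 1
  capacity leaf = 1

  pairCount : Subset (p * 2) → Fin p → ℕ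
  pairCount X j = ∑[ s < 2 ] 𝟙 (lookup X (vertex j s))

  pairCount-I-at : ∀ k a → ∑[ s < 2 ] 𝟙 (free? k ∨ does (s ≟ a)) ≡ capacity k
  pairCount-I-at free a  = refl
  pairCount-I-at hub  0F = refl
  pairCount-I-at hub  1F = refl
  pairCount-I-at leaf 0F = refl
  pairCount-I-at leaf 1F = refl

  pairCount-I : ∀ γ j → pairCount (I γ) j ≡ capacity (shape j)
  pairCount-I γ j = trans (sum-cong-≗ λ s → cong 𝟙 (lookup-I γ j s)) (pairCount-I-at (shape j) (γ j))

  ∣I∣ : ∀ γ → ∣ I γ ∣ ≡ ∑[ j < p ] capacity (shape j)
  ∣I∣ γ = trans (∣p∣≡∑∑ {p} {2} (I γ)) (sum-cong-≗ (pairCount-I γ))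

  pair-adjacent : ∀ {j} → α j ≢ β j → adjacent (j , 0F) (j , 1F) ≡ true
  pair-adjacent {j} αⱼ≢βⱼ rewrite 0F-xor-1F (α j) | dec-true (j ≟ j) refl with shape j | shape-spec j
  ... | free | free αⱼ≡βⱼ = contradiction αⱼ≡βⱼ αⱼ≢βⱼ
  ... | hub  | hub  _ _   = refl
  ... | leaf | leaf _ _   = refl

  pairCount≤1 : ∀ {X j} → Independent G X → α j ≢ β j → pairCount X j ≤ 1
  pairCount≤1 {X} {j} indX αⱼ≢βⱼ with lookup X (vertex j 0F) in x₀ | lookup X (vertex j 1F) in x₁
  ... | false | _     = +-mono-≤ (𝟙≤1 _) z≤n
  ... | true  | false = s≤s z≤n
  ... | true  | true  = contradiction (indX _ _ (lookup⇒[]= _ X x₀) (lookup⇒[]= _ X x₁)) λ nonadjacent →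
    contradiction (trans (sym nonadjacent) (trans (adj-G j 0F j 1F) (pair-adjacent αⱼ≢βⱼ))) λ ()

  pairCount≤capacity : ∀ {X} → Independent G X → ∀ j → pairCount X j ≤ capacity (shape j)
  pairCount≤capacity {X} indX j with shape j | shape-spec j
  ... | free | _            =
    +-mono-≤ (𝟙≤1 (lookup X (vertex j 0F))) (+-mono-≤ (𝟙≤1 (lookup X (vertex j 1F))) z≤n)
  ... | hub  | hub  αⱼ≢βⱼ _ = pairCount≤1 {X} {j} indX αⱼ≢βⱼ
  ... | leaf | leaf αⱼ≢βⱼ _ = pairCount≤1 {X} {j} indX αⱼ≢βⱼ

  pairCount-j₀ : ∀ {X} → lookup X hubα ≡ false → lookup X hubβ ≡ false → pairCount X j₀ ≡ 0
  pairCount-j₀ {X} hubα∉X hubβ∉X = cong₂ (λ x y → 𝟙 x + (𝟙 y + 0)) (absent 0F) (absent 1F)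
    where
    absent : ∀ s → lookup X (vertex j₀ s) ≡ false
    absent s with Fin2-cover α₀≢β₀ s
    ... | inj₁ refl = hubα∉X
    ... | inj₂ refl = hubβ∉X

  ∣X∣≤∣I∣ : ∀ {X} → Independent G X → ∀ γ → ∣ X ∣ ≤ ∣ I γ ∣
  ∣X∣≤∣I∣ {X} indX γ = begin
    ∣ X ∣                         ≡⟨ ∣p∣≡∑∑ {p} {2} X ⟩
    ∑[ j < p ] pairCount X j      ≤⟨ sum-mono-≤ (pairCount≤capacity indX) ⟩
    ∑[ j < p ] capacity (shape j) ≡⟨ ∣I∣ γ ⟨
    ∣ I γ ∣                       ∎
    where open ≤-Reasoning

  ∣X∣<∣Iα∣ : ∀ {X} → Independent G X → lookup X hubα ≡ false → lookup X hubβ ≡ false → ∣ X ∣ < ∣ I α ∣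
  ∣X∣<∣Iα∣ {X} indX hubα∉X hubβ∉X = begin-strict
    ∣ X ∣                         ≡⟨ ∣p∣≡∑∑ {p} {2} X ⟩
    ∑[ j < p ] pairCount X j      <⟨ sum-mono-< (pairCount≤capacity indX) j₀ j₀-deficient ⟩
    ∑[ j < p ] capacity (shape j) ≡⟨ ∣I∣ α ⟨
    ∣ I α ∣                       ∎
    where
    open ≤-Reasoning
    j₀-deficient : pairCount X j₀ < capacity (shape j₀)
    j₀-deficient rewrite pairCount-j₀ {X} hubα∉X hubβ∉X | shape-j₀ = s≤s z≤n

  I-maximum : ∀ {γ b} → OneSided γ b → MaxIndependent G (I γ)
  I-maximum {γ} oneSided = I-independent oneSided , λ Y indY → ∣X∣≤∣I∣ indY γ

  -- A maximum independent set meets the hub pair, and the non-neighbours of a hub vertex lie in I α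
  -- or in I β.
  maximum⇒I : ∀ X → MaxIndependent G X → X ≡ I α ⊎ X ≡ I β
  maximum⇒I X (indX , maxX) with lookup X hubα in hubα∈X | lookup X hubβ in hubβ∈X
  ... | true  | _     = inj₁ (p⊆q∧∣q∣≤∣p∣⇒p≡q (⊆I α-one-sided indX (lookup⇒[]= hubα X hubα∈X))
                                            (maxX (I α) (I-independent α-one-sided)))
  ... | false | true  = inj₂ (p⊆q∧∣q∣≤∣p∣⇒p≡q (⊆I β-one-sided indX (lookup⇒[]= hubβ X hubβ∈X))
                                            (maxX (I β) (I-independent β-one-sided)))
  ... | false | false = contradiction (maxX (I α) (I-independent α-one-sided))
                                      (<⇒≱ (∣X∣<∣Iα∣ indX hubα∈X hubβ∈X))

  Iα≢Iβ : I α ≢ I β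
  Iα≢Iβ Iα≡Iβ = contradiction (trans (sym hubα∈Iα) (trans (cong (λ X → lookup X hubα) Iα≡Iβ) hubα∉Iβ)) λ ()
    where
    hubα∈Iα : lookup (I α) hubα ≡ true
    hubα∈Iα rewrite lookup-I α j₀ (α j₀) | side-α j₀ = ∨-zeroʳ _
    hubα∉Iβ : lookup (I β) hubα ≡ false
    hubα∉Iβ rewrite lookup-I β j₀ (α j₀) | shape-j₀ = dec-false (α j₀ ≟ β j₀) α₀≢β₀

  weight-Iα≡Iβ : ∀ ω → weight ω (selection α) ≡ weight ω (selection β) → weight ω (I α) ≡ weight ω (I β)
  weight-Iα≡Iβ ω same = +-cancelʳ-≡ (weight ω (selection β)) _ _ (begin
    weight ω (I α) + weight ω (selection β)
      ≡⟨ weight-∪-exchange ω freeVertices (selection α) (selection β) agree ⟩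
    weight ω (I β) + weight ω (selection α) ≡⟨ cong (weight ω (I β) +_) same ⟩
    weight ω (I β) + weight ω (selection β) ∎)
    where
    open ≡-Reasoning
    agree : ∀ v → lookup freeVertices v ≡ true → lookup (selection α) v ≡ lookup (selection β) v
    agree = ∀-vertex _ λ j s freeⱼ → let freeⱼ' = trans (sym (lookup-onPairs _ j s)) freeⱼ in begin
      lookup (selection α) (vertex j s) ≡⟨ lookup-onPairs _ j s ⟩
      does (s ≟ α j)                    ≡⟨ cong (does ∘ (s ≟_)) (free⇒α≡β freeⱼ') ⟩
      does (s ≟ β j)                    ≡⟨ lookup-onPairs _ j s ⟨
      lookup (selection β) (vertex j s) ∎

  ¬isolates : ∀ ω → weight ω (selection α) ≡ weight ω (selection β) → ¬ Isolates ω (MaxIndependent G)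
  ¬isolates ω same =
    ¬Isolates-pair (I-maximum α-one-sided) (I-maximum β-one-sided) Iα≢Iβ maximum⇒I (weight-Iα≡Iβ ω same)

no-isolating-weights : ∀ p {L B} (ω : Fin L → Fin (p * 2) → ℕ) → (∀ i X → weight (ω i) X < B) →
  B ^ L < 2 ^ p → ∃[ G ] TreedepthAtMost 4 G × (∀ i → ¬ Isolates (ω i) (MaxIndependent G))
no-isolating-weights p ω weight<B B^L<2^p
  with pigeonhole-→ {l = p} B^L<2^p (λ γ i → fromℕ< (weight<B i (selection γ)))
... | α , β , (j₀ , α₀≢β₀) , same-weights =
  G , treedepth≤4 , λ i → ¬isolates (ω i) (fromℕ<-injective _ _ _ _ (same-weights i))
  where open Gadget α β j₀ α₀≢β₀

isolating-member : ∀ {d ℓ ω} → IsIsolationScheme d ℓ ω → ∀ n (G : Graph n) → TreedepthAtMost d G →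
  ∃[ i ] Isolates (ω n i) (MaxIndependent G)
isolating-member (ℓ≥1 , isolating) n G td with isolating n G td
... | S , ℓ≤2∣S∣ , S-isolates with 0<∣p∣⇒Nonempty S (*-cancelˡ-< 2 0 ∣ S ∣ (≤-trans (ℓ≥1 n) ℓ≤2∣S∣))
...   | i , i∈S = i , S-isolates i i∈S

corollary7p1 : (ℓ : ℕ → ℕ) → (ω : (n : ℕ) → Fin (ℓ n) → Fin n → ℕ) →
    IsIsolationScheme 4 ℓ ω → LittleOLog ℓ → ¬ PolyBoundedWeights ℓ ω
corollary7p1 ℓ ω scheme o-log (c , N₁ , ω≤n^c) =
  let (N₂ , ℓ²≤n) = o-log 1
      (p , N₁+N₂≤n , room) = enough-pairs c (N₁ + N₂)
      n = p * 2
      weight<B : ∀ i X → weight (ω n i) X < suc (n ^ suc c)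
      weight<B i X = s≤s (weight≤ (ω n i) (ω≤n^c n (≤-trans (m≤m+n N₁ N₂) N₁+N₂≤n) i) X)
      B^ℓ<2^p = room (ℓ n) (ℓ²≤n n (≤-trans (m≤n+m N₂ N₁) N₁+N₂≤n))
      (G , td , none) = no-isolating-weights p (ω n) weight<B B^ℓ<2^p
      (i , isolates) = isolating-member scheme n G td
  in none i isolates
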